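{- The Steinhaus-Johnson-Trotter cycle $\Lambda_n$ in the permutahedron $\Pi_n$ has compression factor $\kappa(\Pi_n,\Lambda_n)=6$ for $n=3,4$ and $\kappa(\Pi_n,\Lambda_n)=3$ for all $n\ge 5$.
   Context: $\Pi_n$ has as vertices all permutations of $\{1,\ldots,n\}$ in one-line notation, adjacent iff they differ by swapping the entries in two adjacent positions. The Steinhaus-Johnson-Trotter sequence is defined by $\Lambda_1:=(1)$ and, for $n\ge2$, $\Lambda_n$ is obtained from $\Lambda_{n-1}$ by replacing each permutation of $\{1,\ldots,n-1\}$ by the $n$ permutations obtained by inserting the value $n$ into every possible position, going from right to left for the first permutation of $\Lambda_{n-1}$, from left to right for the second, and alternating thereafter (e.g. $\Lambda_3=123,132,312,321,231,213$); $\Lambda_n$ is a Hamilton cycle of $\Pi_n$ for $n\ge 3$. For a graph $G$ with $N$ vertices, a Hamilton cycle $C=(x_1,\ldots,x_N)$ is $k$-symmetric (for a positive integer $k$ dividing $N$) if the map $x_i\mapsto x_{i+N/k}$ (indices modulo $N$) is an automorphism of $G$; $\kappa(G,C)$ is the largest such $k$. -}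

module Defs where

open import Data.Nat using (ℕ; zero; suc; _+_; _*_; _∸_; _<_; _≤_; _<ᵇ_)
open import Data.Bool using (Bool; true; false; if_then_else_)
open import Data.List using (List; []; _∷_; _++_; [_]; take; drop; length; upTo; map; reverse; concat)
open import Data.List.Relation.Binary.Permutation.Propositional using (_↭_)
open import Data.Product using (Σ; ∃; _×_; _,_)
open import Relation.Binary.PropositionalEquality using (_≡_)
open import Function.Bundles using (_⇔_)

-- Vertices of Π_n: permutations of {1,…,n} in one-line notation (lists).
IsPerm : ℕ → List ℕ → Set
IsPerm n p = p ↭ map suc (upTo n)

swapAt : ℕ → List ℕ → List ℕ
swapAt zero (a ∷ b ∷ xs) = b ∷ a ∷ xs
swapAt zero xs = xs
swapAt (suc i) [] = []
swapAt (suc i) (a ∷ xs) = a ∷ swapAt i xs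

Adj : List ℕ → List ℕ → Set
Adj p q = Σ ℕ λ i → (suc i < length p) × (q ≡ swapAt i p)

IsAutΠ : ℕ → (List ℕ → List ℕ) → Set
IsAutΠ n f =
  (∀ p → IsPerm n p → IsPerm n (f p)) ×
  (∀ p q → IsPerm n p → IsPerm n q → f p ≡ f q → p ≡ q) ×
  (∀ q → IsPerm n q → Σ (List ℕ) λ p → IsPerm n p × (f p ≡ q)) ×
  (∀ p q → IsPerm n p → IsPerm n q → (Adj p q ⇔ Adj (f p) (f q)))

insertAt : ℕ → ℕ → List ℕ → List ℕ
insertAt v j p = take j p ++ [ v ] ++ drop j p

insertionsRL : ℕ → List ℕ → List (List ℕ)
insertionsRL v p = map (λ j → insertAt v j p) (reverse (upTo (suc (length p))))

insertionsLR : ℕ → List ℕ → List (List ℕ)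
insertionsLR v p = map (λ j → insertAt v j p) (upTo (suc (length p)))

expand : ℕ → Bool → List (List ℕ) → List (List ℕ)
expand v b [] = []
expand v true (p ∷ ps) = insertionsRL v p ++ expand v false ps
expand v false (p ∷ ps) = insertionsLR v p ++ expand v true ps

-- Steinhaus–Johnson–Trotter sequence Λ_n (Λ_0 is a junk value, unused)
SJT : ℕ → List (List ℕ)
SJT zero = [ [] ]
SJT (suc zero) = [ [ 1 ] ]
SJT (suc (suc n)) = expand (suc (suc n)) true (SJT (suc n))

-- i-th entry of a list (0-based); default [] outside the range
nth : List (List ℕ) → ℕ → List ℕ
nth [] i = []
nth (x ∷ xs) zero = x
nth (x ∷ xs) (suc i) = nth xs i

-- index i+s taken modulo N, for 0 ≤ i < N and 0 < s ≤ N
shiftIdx : ℕ → ℕ → ℕ → ℕ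
shiftIdx N s i = if (i + s) <ᵇ N then i + s else (i + s) ∸ N

KSymmetric : ℕ → List (List ℕ) → ℕ → Set
KSymmetric n C k =
  (0 < k) ×
  Σ ℕ λ s → (s * k ≡ length C) ×
    Σ (List ℕ → List ℕ) λ f → IsAutΠ n f ×
      (∀ i → i < length C → f (nth C i) ≡ nth C (shiftIdx (length C) s i))

CompressionFactor : ℕ → List (List ℕ) → ℕ → Set
CompressionFactor n C k =
  KSymmetric n C k × (∀ k′ → KSymmetric n C k′ → k′ ≤ k)

{-# OPTIONS --safe #-}
-- Relabelling the values by the 3-cycle τ = (1 3 2) commutes with inserting
-- larger values; since Λ_{n+1} consists of blocks, the m-th of which inserts n + 1 into the m-th
-- entry of Λ_n in a direction depending only on the parity of m, induction on n shows that τ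
-- rotates Λ_n by a third of its length; that third is even, so block directions are respected.
-- For n = 3, 4 the reversal followed by τ⁻¹ rotates Λ_n by a sixth, checked by computation.
--
-- A k-symmetry rotates Λ_n by s = |Λ_n| / k while preserving adjacency among its
-- entries. For n ≥ 5 the entries x_{n-2} and x_{n+1} are adjacent, and entries three apart are
-- adjacent only at that offset within a block, so s ≤ |Λ_n| / 4 must be a multiple m·n of n.
-- The entries of Λ_n with n at the front then show that the rotation of Λ_{n-1} by m preserves
-- adjacency too. Descending to n = 5 leaves a few shifts, each refuted by an explicit pair of
-- entries, as are the small shifts for n = 4.
module Submission where

open import Defs
open import Data.Bool using (Bool; true; false; not; T)
open import Data.Empty using (⊥-elim)
open import Data.Unit using (tt)
open import Data.List using (List; []; _∷_; _++_; [_]; map; reverse; upTo; downFrom; applyUpTo; length; take; drop)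
import Data.List.Properties as List
open import Data.List.Membership.Propositional using (_∈_)
open import Data.List.Membership.Propositional.Properties using (∈-applyUpTo⁻)
open import Data.List.Relation.Binary.Permutation.Propositional using (_↭_; prep; swap; ↭-refl; ↭-sym; ↭-trans; ↭-reflexive; module PermutationReasoning)
open import Data.List.Relation.Binary.Permutation.Propositional.Properties using (shift; ∷↭∷ʳ; ↭-length; ∈-resp-↭; map⁺; ++⁺ʳ; ↭-reverse)
open import Data.List.Relation.Unary.All using (All; []; _∷_)
import Data.List.Relation.Unary.All as All
import Data.List.Relation.Unary.All.Properties as All
open import Data.List.Relation.Unary.Any using (here; there)
open import Data.Nat using (ℕ; zero; suc; _+_; _*_; _∸_; _≤_; _<_; _≤?_; _<?_; _≟_; _<ᵇ_; z≤n; s≤s; parity)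
open import Data.Nat.Properties
open import Data.Nat.DivMod using (_/_; _%_; m<n*o⇒m/o<n; m%n<n; m≡m%n+[m/n]*n)
open import Data.Nat.Tactic.RingSolver using (solve-∀)
open import Data.Parity using (Parity; 0ℙ; 1ℙ; _⁻¹)
import Data.Parity as ℙ
import Data.Parity.Properties as ℙ
open import Data.Product using (∃; _×_; _,_; proj₁; proj₂)
open import Data.Sum using (_⊎_; inj₁; inj₂)
import Data.Sum as Sum
open import Function using (_∘_)
open import Function.Bundles using (mk⇔; Equivalence)
import Function.Properties.Equivalence as ⇔
open import Relation.Binary.PropositionalEquality using (_≡_; refl; sym; trans; cong; cong₂; subst; subst₂; module ≡-Reasoning)
open import Relation.Nullary using (¬_; Dec; yes; no)
open import Relation.Nullary.Decidable using (map′; _×-dec_; True; False; toWitness; toWitnessFalse; from-yes; from-no)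

nth-++ˡ : ∀ (xs ys : List (List ℕ)) {i} → i < length xs → nth (xs ++ ys) i ≡ nth xs i
nth-++ˡ (x ∷ xs) ys {zero} _ = refl
nth-++ˡ (x ∷ xs) ys {suc i} (s≤s i<) = nth-++ˡ xs ys i<

nth-++ʳ : ∀ (xs ys : List (List ℕ)) k → nth (xs ++ ys) (length xs + k) ≡ nth ys k
nth-++ʳ [] ys k = refl
nth-++ʳ (x ∷ xs) ys k = nth-++ʳ xs ys k

nth-applyUpTo : ∀ (g : ℕ → List ℕ) n {t} → t < n → nth (applyUpTo g n) t ≡ g t
nth-applyUpTo g (suc n) {zero} _ = refl
nth-applyUpTo g (suc n) {suc t} (s≤s t<) = nth-applyUpTo (g ∘ suc) n t<

nth-map-downFrom : ∀ (g : ℕ → List ℕ) n {t} → t ≤ n → nth (map g (downFrom (suc n))) t ≡ g (n ∸ t)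
nth-map-downFrom g n {zero} _ = refl
nth-map-downFrom g (suc n) {suc t} (s≤s t≤) = nth-map-downFrom g n t≤

nth-All : ∀ {P : List ℕ → Set} {L} i → All P L → i < length L → P (nth L i)
nth-All zero (px ∷ _) _ = px
nth-All (suc i) (_ ∷ pxs) (s≤s i<) = nth-All i pxs i<

length-insertAt : ∀ v j p → length (insertAt v j p) ≡ suc (length p)
length-insertAt v zero p = refl
length-insertAt v (suc j) [] = refl
length-insertAt v (suc j) (a ∷ p) = cong suc (length-insertAt v j p)

map-insertAt : ∀ (h : ℕ → ℕ) v j p → map h (insertAt v j p) ≡ insertAt (h v) j (map h p)
map-insertAt h v zero p = refl
map-insertAt h v (suc j) [] = refl
map-insertAt h v (suc j) (a ∷ p) = cong (h a ∷_) (map-insertAt h v j p)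

insertAt-injective : ∀ {v j j′ π π′} → ¬ v ∈ π → ¬ v ∈ π′ → j ≤ length π → j′ ≤ length π′ →
  insertAt v j π ≡ insertAt v j′ π′ → j ≡ j′ × π ≡ π′
insertAt-injective {j = zero} {zero} _ _ _ _ refl = refl , refl
insertAt-injective {j = zero} {suc j′} {π′ = a ∷ π′} _ v∉π′ _ _ refl = ⊥-elim (v∉π′ (here refl))
insertAt-injective {j = suc j} {zero} {a ∷ π} v∉π _ _ _ refl = ⊥-elim (v∉π (here refl))
insertAt-injective {j = suc j} {suc j′} {a ∷ π} {a′ ∷ π′} v∉π v∉π′ (s≤s j≤) (s≤s j′≤) eq
  with refl , eq′ ← List.∷-injective eq
  with refl , refl ← insertAt-injective (v∉π ∘ there) (v∉π′ ∘ there) j≤ j′≤ eq′ = refl , refl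

insertAt-suc : ∀ v j ρ → suc j ≤ length ρ → insertAt v (suc j) ρ ≡ swapAt j (insertAt v j ρ)
insertAt-suc v zero (a ∷ ρ) _ = refl
insertAt-suc v (suc j) (a ∷ ρ) (s≤s j<) = cong (a ∷_) (insertAt-suc v j ρ j<)

swapAt-involutive : ∀ i (p : List ℕ) → swapAt i (swapAt i p) ≡ p
swapAt-involutive zero [] = refl
swapAt-involutive zero (a ∷ []) = refl
swapAt-involutive zero (a ∷ b ∷ p) = refl
swapAt-involutive (suc i) [] = refl
swapAt-involutive (suc i) (a ∷ p) = cong (a ∷_) (swapAt-involutive i p)

length-swapAt : ∀ i (p : List ℕ) → length (swapAt i p) ≡ length p
length-swapAt zero [] = refl
length-swapAt zero (a ∷ []) = refl
length-swapAt zero (a ∷ b ∷ p) = refl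
length-swapAt (suc i) [] = refl
length-swapAt (suc i) (a ∷ p) = cong suc (length-swapAt i p)

map-swapAt : ∀ (h : ℕ → ℕ) i p → map h (swapAt i p) ≡ swapAt i (map h p)
map-swapAt h zero [] = refl
map-swapAt h zero (a ∷ []) = refl
map-swapAt h zero (a ∷ b ∷ p) = refl
map-swapAt h (suc i) [] = refl
map-swapAt h (suc i) (a ∷ p) = cong (h a ∷_) (map-swapAt h i p)

swapAt-++ˡ : ∀ i (xs ys : List ℕ) → suc i < length xs → swapAt i (xs ++ ys) ≡ swapAt i xs ++ ys
swapAt-++ˡ zero (a ∷ []) ys (s≤s ())
swapAt-++ˡ zero (a ∷ b ∷ xs) ys _ = refl
swapAt-++ˡ (suc i) (a ∷ xs) ys (s≤s i<) = cong (a ∷_) (swapAt-++ˡ i xs ys i<)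

Adj-sym : ∀ {p q} → Adj p q → Adj q p
Adj-sym {p} (i , i< , refl) =
  i , subst (suc i <_) (sym (length-swapAt i p)) i< , sym (swapAt-involutive i p)

Adj-∷ : ∀ v {p q} → Adj p q → Adj (v ∷ p) (v ∷ q)
Adj-∷ v (i , i< , eq) = suc i , s≤s i< , cong (v ∷_) eq

Adj-++ʳ : ∀ {p q} zs → Adj p q → Adj (p ++ zs) (q ++ zs)
Adj-++ʳ {p} zs (i , i< , refl) =
  i , ≤-trans i< (List.length-++-≤ˡ p) , sym (swapAt-++ˡ i p zs i<)

Adj-++-swapLast : ∀ (xs : List ℕ) a b → Adj (xs ++ a ∷ b ∷ []) (xs ++ b ∷ a ∷ [])
Adj-++-swapLast [] a b = zero , s≤s (s≤s z≤n) , refl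
Adj-++-swapLast (x ∷ xs) a b = Adj-∷ x (Adj-++-swapLast xs a b)

Adj-reverse : ∀ {p q} → Adj p q → Adj (reverse p) (reverse q)
Adj-reverse {a ∷ b ∷ r} (zero , _ , refl) =
  subst₂ Adj (sym (List.reverse-++ (a ∷ b ∷ []) r)) (sym (List.reverse-++ (b ∷ a ∷ []) r))
    (Adj-++-swapLast (reverse r) b a)
Adj-reverse {a ∷ p} (suc i , s≤s i< , refl) =
  subst₂ Adj (sym (List.reverse-++ [ a ] p)) (sym (List.reverse-++ [ a ] (swapAt i p)))
    (Adj-++ʳ [ a ] (Adj-reverse (i , i< , refl)))

Adj? : ∀ p q → Dec (Adj p q)
Adj? p q = map′ fromBounded toBounded
  (anyUpTo? (λ i → (suc i <? length p) ×-dec List.≡-dec _≟_ q (swapAt i p)) (length p))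
  where
  fromBounded : (∃ λ i → i < length p × suc i < length p × q ≡ swapAt i p) → Adj p q
  fromBounded (i , _ , i< , eq) = i , i< , eq
  toBounded : Adj p q → ∃ λ i → i < length p × suc i < length p × q ≡ swapAt i p
  toBounded (i , i< , eq) = i , <-trans (n<1+n i) i< , i< , eq

Adj-insertAt-left : ∀ v {j i π} → j ≤ i → suc i < length π → Adj (insertAt v j π) (insertAt v j (swapAt i π))
Adj-insertAt-left v {zero} {i} _ i< = Adj-∷ v (i , i< , refl)
Adj-insertAt-left v {suc j} {suc i} {a ∷ π} (s≤s j≤i) (s≤s i<) = Adj-∷ a (Adj-insertAt-left v j≤i i<)

data InsertionStep (j : ℕ) (π : List ℕ) (j′ : ℕ) (π′ : List ℕ) : Set where
  moveOthers : j ≡ j′ → Adj π π′ → InsertionStep j π j′ π′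
  moveInserted : π ≡ π′ → suc j ≡ j′ ⊎ suc j′ ≡ j → InsertionStep j π j′ π′

insertionStep-sym : ∀ {j π j′ π′} → InsertionStep j π j′ π′ → InsertionStep j′ π′ j π
insertionStep-sym (moveOthers refl adj) = moveOthers refl (Adj-sym adj)
insertionStep-sym (moveInserted refl d) = moveInserted refl (Sum.swap d)

insertionStep-∷ : ∀ a {j π j′ π′} → InsertionStep j π j′ π′ →
  InsertionStep (suc j) (a ∷ π) (suc j′) (a ∷ π′)
insertionStep-∷ a (moveOthers refl adj) = moveOthers refl (Adj-∷ a adj)
insertionStep-∷ a (moveInserted refl (inj₁ refl)) = moveInserted refl (inj₁ refl)
insertionStep-∷ a (moveInserted refl (inj₂ refl)) = moveInserted refl (inj₂ refl)

insertionStep-≤ : ∀ {j π j′ π′} → InsertionStep j π j′ π′ → j′ ≤ suc j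
insertionStep-≤ (moveOthers refl _) = n≤1+n _
insertionStep-≤ (moveInserted _ (inj₁ refl)) = ≤-refl
insertionStep-≤ (moveInserted _ (inj₂ refl)) = ≤-trans (n≤1+n _) (n≤1+n _)

insertionStep-sameSlot : ∀ {j π π′} → InsertionStep j π j π′ → Adj π π′
insertionStep-sameSlot (moveOthers _ adj) = adj
insertionStep-sameSlot {j} (moveInserted _ (inj₁ eq)) = ⊥-elim (1+n≢n eq)
insertionStep-sameSlot {j} (moveInserted _ (inj₂ eq)) = ⊥-elim (1+n≢n eq)

Adj-∷-insertAt⁻ : ∀ {v π j′ π′} → ¬ v ∈ π → ¬ v ∈ π′ → j′ ≤ length π′ →
  Adj (v ∷ π) (insertAt v j′ π′) → InsertionStep zero π j′ π′
Adj-∷-insertAt⁻ {π = []} _ _ _ (zero , s≤s () , _)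
Adj-∷-insertAt⁻ {π = a ∷ π} {zero} v∉π _ _ (zero , _ , refl) = ⊥-elim (v∉π (here refl))
Adj-∷-insertAt⁻ {j′ = suc j′} {[]} _ _ () _
Adj-∷-insertAt⁻ {π = a ∷ π} {suc zero} {_ ∷ _} _ _ _ (zero , _ , refl) = moveInserted refl (inj₁ refl)
Adj-∷-insertAt⁻ {π = a ∷ π} {suc (suc j′)} {_ ∷ _ ∷ _} _ v∉π′ _ (zero , _ , refl) =
  ⊥-elim (v∉π′ (there (here refl)))
Adj-∷-insertAt⁻ {j′ = suc (suc j′)} {_ ∷ []} _ _ (s≤s ()) _
Adj-∷-insertAt⁻ {j′ = zero} _ _ _ (suc i , s≤s i< , eq) = moveOthers refl (i , i< , List.∷-injectiveʳ eq)
Adj-∷-insertAt⁻ {j′ = suc j′} {_ ∷ _} _ v∉π′ _ (suc i , _ , eq) =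
  ⊥-elim (v∉π′ (here (sym (List.∷-injectiveˡ eq))))

Adj-insertAt⁻ : ∀ {v j π j′ π′} → ¬ v ∈ π → ¬ v ∈ π′ → j ≤ length π → j′ ≤ length π′ →
  Adj (insertAt v j π) (insertAt v j′ π′) → InsertionStep j π j′ π′
Adj-insertAt⁻ {j = zero} v∉π v∉π′ _ j′≤ adj = Adj-∷-insertAt⁻ v∉π v∉π′ j′≤ adj
Adj-insertAt⁻ {j = suc j} {j′ = zero} v∉π v∉π′ j≤ _ adj =
  insertionStep-sym (Adj-∷-insertAt⁻ v∉π′ v∉π j≤ (Adj-sym adj))
Adj-insertAt⁻ {j = suc j} {a ∷ π} {suc j′} {a′ ∷ π′} v∉π v∉π′ (s≤s j≤) (s≤s j′≤) (suc i , s≤s i< , eq)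
  with refl , eq′ ← List.∷-injective eq =
  insertionStep-∷ a (Adj-insertAt⁻ (v∉π ∘ there) (v∉π′ ∘ there) j≤ j′≤ (i , i< , eq′))
Adj-insertAt⁻ {j = suc zero} {a ∷ π} {suc j′} {a′ ∷ π′} _ v∉π′ _ _ (zero , _ , eq) =
  ⊥-elim (v∉π′ (here (sym (List.∷-injectiveˡ eq))))
Adj-insertAt⁻ {j = suc (suc j)} {a ∷ b ∷ π} {suc zero} {a′ ∷ π′} v∉π _ _ _ (zero , _ , refl) =
  ⊥-elim (v∉π (here refl))
Adj-insertAt⁻ {j = suc (suc j)} {a ∷ b ∷ π} {suc (suc j′)} {_ ∷ _ ∷ π′} v∉π v∉π′ (s≤s (s≤s j≤)) (s≤s (s≤s j′≤))
  (zero , _ , eq)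
  with refl , eq′ ← List.∷-injective eq
  with refl , eq″ ← List.∷-injective eq′
  with refl , refl ← insertAt-injective (v∉π′ ∘ there ∘ there) (v∉π ∘ there ∘ there) j′≤ j≤ eq″ =
  moveOthers refl (zero , s≤s (s≤s z≤n) , refl)

insertionStep-far : ∀ {j π j′ π′} → 2 + j ≤ j′ → ¬ InsertionStep j π j′ π′
insertionStep-far 2+j≤j′ step = 1+n≰n (≤-trans 2+j≤j′ (insertionStep-≤ step))

insertionStep-ends : ∀ {n j π j′ π′} → 2 ≤ n → j ≡ 0 ⊎ j ≡ n → j′ ≡ 0 ⊎ j′ ≡ n →
  InsertionStep j π j′ π′ → Adj π π′
insertionStep-ends _ (inj₁ refl) (inj₁ refl) step = insertionStep-sameSlot step
insertionStep-ends _ (inj₂ refl) (inj₂ refl) step = insertionStep-sameSlot step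
insertionStep-ends 2≤n (inj₁ refl) (inj₂ refl) step = ⊥-elim (insertionStep-far 2≤n step)
insertionStep-ends 2≤n (inj₂ refl) (inj₁ refl) step = ⊥-elim (insertionStep-far 2≤n (insertionStep-sym step))

oneTo : ℕ → List ℕ
oneTo n = map suc (upTo n)

oneTo-suc : ∀ n → oneTo (suc n) ≡ oneTo n ++ [ suc n ]
oneTo-suc n = trans (cong (map suc) (sym (List.upTo-∷ʳ n))) (List.map-++ suc (upTo n) [ n ])

suc∉oneTo : ∀ n → ¬ suc n ∈ oneTo n
suc∉oneTo n n+1∈ with i , i<n , eq ← ∈-applyUpTo⁻ suc (subst (suc n ∈_) (List.map-upTo suc n) n+1∈) =
  <-irrefl (sym (suc-injective eq)) i<n

IsPerm-length : ∀ {n p} → IsPerm n p → length p ≡ n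
IsPerm-length {n} p↭ = trans (↭-length p↭) (trans (List.length-map suc (upTo n)) (List.length-upTo n))

IsPerm-∉ : ∀ {n p} → IsPerm n p → ¬ suc n ∈ p
IsPerm-∉ {n} p↭ n+1∈ = suc∉oneTo n (∈-resp-↭ p↭ n+1∈)

IsPerm-insertAt : ∀ {n π} j → IsPerm n π → IsPerm (suc n) (insertAt (suc n) j π)
IsPerm-insertAt {n} {π} j π↭ = begin
  take j π ++ [ suc n ] ++ drop j π  ↭⟨ shift (suc n) (take j π) (drop j π) ⟩
  suc n ∷ take j π ++ drop j π       ≡⟨ cong (suc n ∷_) (List.take++drop≡id j π) ⟩
  suc n ∷ π                          ↭⟨ prep (suc n) π↭ ⟩
  suc n ∷ oneTo n                    ↭⟨ ∷↭∷ʳ (suc n) (oneTo n) ⟩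
  oneTo n ++ [ suc n ]               ≡⟨ oneTo-suc n ⟨
  oneTo (suc n)                      ∎
  where open PermutationReasoning

IsAutΠ-∘ : ∀ {n f g} → IsAutΠ n f → IsAutΠ n g → IsAutΠ n (f ∘ g)
IsAutΠ-∘ {f = f} {g} (f-perm , f-inj , f-surj , f-adj) (g-perm , g-inj , g-surj , g-adj) =
  (λ p p↭ → f-perm (g p) (g-perm p p↭)) ,
  (λ p q p↭ q↭ eq → g-inj p q p↭ q↭ (f-inj (g p) (g q) (g-perm p p↭) (g-perm q q↭) eq)) ,
  (λ q q↭ → let r , r↭ , fr≡q = f-surj q q↭
                p , p↭ , gp≡r = g-surj r r↭
            in p , p↭ , trans (cong f gp≡r) fr≡q) ,
  (λ p q p↭ q↭ → ⇔.trans
     (g-adj p q p↭ q↭) (f-adj (g p) (g q) (g-perm p p↭) (g-perm q q↭)))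

IsAutΠ-reverse : ∀ n → IsAutΠ n reverse
IsAutΠ-reverse n =
  (λ p p↭ → ↭-trans (↭-reverse p) p↭) ,
  (λ p q _ _ → List.reverse-injective) ,
  (λ q q↭ → reverse q , ↭-trans (↭-reverse q) q↭ , List.reverse-involutive q) ,
  (λ p q _ _ → mk⇔ Adj-reverse
     (subst₂ Adj (List.reverse-involutive p) (List.reverse-involutive q) ∘ Adj-reverse))

IsAutΠ-relabel : ∀ n (h h⁻¹ : ℕ → ℕ) → (∀ x → h⁻¹ (h x) ≡ x) → (∀ x → h (h⁻¹ x) ≡ x) →
  map h (oneTo n) ↭ oneTo n → IsAutΠ n (map h)
IsAutΠ-relabel n h h⁻¹ h⁻¹∘h h∘h⁻¹ h↭ =
  (λ p p↭ → ↭-trans (map⁺ h p↭) h↭) ,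
  (λ p q _ _ → List.map-injective h-injective) ,
  (λ q q↭ → map h⁻¹ q , ↭-trans (map⁺ h⁻¹ q↭) h⁻¹↭ , map-inverse h∘h⁻¹ q) ,
  (λ p q _ _ → mk⇔
     (λ (i , i< , eq) → i , subst (suc i <_) (sym (List.length-map h p)) i< ,
                        trans (cong (map h) eq) (map-swapAt h i p))
     (λ (i , i< , eq) → i , subst (suc i <_) (List.length-map h p) i< ,
                        List.map-injective h-injective (trans eq (sym (map-swapAt h i p)))))
  where
  h-injective : ∀ {x y} → h x ≡ h y → x ≡ y
  h-injective {x} {y} eq = trans (sym (h⁻¹∘h x)) (trans (cong h⁻¹ eq) (h⁻¹∘h y))
  map-inverse : ∀ {g g′ : ℕ → ℕ} → (∀ x → g (g′ x) ≡ x) → ∀ xs → map g (map g′ xs) ≡ xs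
  map-inverse inv xs = trans (sym (List.map-∘ xs)) (trans (List.map-cong inv xs) (List.map-id xs))
  h⁻¹↭ : map h⁻¹ (oneTo n) ↭ oneTo n
  h⁻¹↭ = ↭-sym (↭-trans (↭-reflexive (sym (map-inverse h⁻¹∘h (oneTo n)))) (map⁺ h⁻¹ h↭))

map-oneTo-↭ : ∀ m (h : ℕ → ℕ) → (∀ x → h (suc m + x) ≡ suc m + x) → map h (oneTo m) ↭ oneTo m →
  ∀ k → map h (oneTo (m + k)) ↭ oneTo (m + k)
map-oneTo-↭ m h fixes h↭ zero = subst (λ n → map h (oneTo n) ↭ oneTo n) (sym (+-identityʳ m)) h↭
map-oneTo-↭ m h fixes h↭ (suc k) = begin
  map h (oneTo (m + suc k))                   ≡⟨ cong (map h) (trans (cong oneTo (+-suc m k)) (oneTo-suc (m + k))) ⟩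
  map h (oneTo (m + k) ++ [ suc (m + k) ])    ≡⟨ List.map-++ h (oneTo (m + k)) _ ⟩
  map h (oneTo (m + k)) ++ [ h (suc (m + k)) ] ≡⟨ cong (λ v → map h (oneTo (m + k)) ++ [ v ]) (fixes k) ⟩
  map h (oneTo (m + k)) ++ [ suc (m + k) ]    ↭⟨ ++⁺ʳ [ suc (m + k) ] (map-oneTo-↭ m h fixes h↭ k) ⟩
  oneTo (m + k) ++ [ suc (m + k) ]            ≡⟨ trans (cong oneTo (+-suc m k)) (oneTo-suc (m + k)) ⟨
  oneTo (m + suc k)                           ∎
  where open PermutationReasoning

-- Entry t of block m of Λ_{n+2} inserts n + 2 at position insertionPos (parity m) (suc n) t:
-- blocks of even index run right to left.
insertionPos : Parity → ℕ → ℕ → ℕ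
insertionPos 0ℙ n t = n ∸ t
insertionPos 1ℙ n t = t

startParity : Bool → Parity
startParity true = 0ℙ
startParity false = 1ℙ

insertions : Bool → ℕ → List ℕ → List (List ℕ)
insertions true = insertionsRL
insertions false = insertionsLR

expand-∷ : ∀ v b p ps → expand v b (p ∷ ps) ≡ insertions b v p ++ expand v (not b) ps
expand-∷ v true p ps = refl
expand-∷ v false p ps = refl

length-insertions : ∀ b v p → length (insertions b v p) ≡ suc (length p)
length-insertions true v p = begin
  length (map _ (reverse (upTo (suc (length p))))) ≡⟨ List.length-map _ (reverse (upTo (suc (length p)))) ⟩
  length (reverse (upTo (suc (length p))))         ≡⟨ List.length-reverse (upTo (suc (length p))) ⟩
  length (upTo (suc (length p)))                   ≡⟨ List.length-upTo (suc (length p)) ⟩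
  suc (length p)                                   ∎
  where open ≡-Reasoning
length-insertions false v p =
  trans (List.length-map _ (upTo (suc (length p)))) (List.length-upTo (suc (length p)))

nth-insertions : ∀ b v p {t} → t ≤ length p →
  nth (insertions b v p) t ≡ insertAt v (insertionPos (startParity b) (length p) t) p
nth-insertions true v p t≤ rewrite List.reverse-upTo (suc (length p)) =
  nth-map-downFrom (λ j → insertAt v j p) (length p) t≤
nth-insertions false v p t≤ rewrite List.map-upTo (λ j → insertAt v j p) (suc (length p)) =
  nth-applyUpTo (λ j → insertAt v j p) (suc (length p)) (s≤s t≤)

parity-suc : ∀ m → parity (suc m) ≡ parity m ⁻¹
parity-suc m = sym (ℙ.⁻¹-selfInverse (ℙ.suc-homo-⁻¹ m))

startParity-not : ∀ b m → startParity (not b) ℙ.+ parity m ≡ startParity b ℙ.+ parity (suc m)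
startParity-not b m = trans (swapParity b (parity m)) (cong (startParity b ℙ.+_) (sym (parity-suc m)))
  where
  swapParity : ∀ b p → startParity (not b) ℙ.+ p ≡ startParity b ℙ.+ p ⁻¹
  swapParity true p = refl
  swapParity false p = sym (ℙ.⁻¹-involutive p)

length-expand : ∀ v b {n} L → All (λ p → length p ≡ n) L → length (expand v b L) ≡ length L * suc n
length-expand v b [] [] = refl
length-expand v b {n} (p ∷ ps) (refl ∷ lengths) rewrite expand-∷ v b p ps =
  trans (List.length-++ (insertions b v p))
        (cong₂ _+_ (length-insertions b v p) (length-expand v (not b) ps lengths))

nth-expand : ∀ v b {n} L → All (λ p → length p ≡ n) L → ∀ {m t} → m < length L → t ≤ n →
  nth (expand v b L) (m * suc n + t) ≡ insertAt v (insertionPos (startParity b ℙ.+ parity m) n t) (nth L m)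
nth-expand v b (p ∷ ps) (refl ∷ _) {zero} {t} _ t≤
  rewrite expand-∷ v b p ps | ℙ.+-identityʳ (startParity b) =
  trans (nth-++ˡ (insertions b v p) _ (subst (t <_) (sym (length-insertions b v p)) (s≤s t≤)))
        (nth-insertions b v p t≤)
nth-expand v b {n} (p ∷ ps) (refl ∷ lengths) {suc m} {t} (s≤s m<) t≤ rewrite expand-∷ v b p ps = begin
  nth (insertions b v p ++ expand v (not b) ps) (suc n + m * suc n + t)
    ≡⟨ cong (nth (insertions b v p ++ _)) (trans (+-assoc (suc n) (m * suc n) t)
         (cong (_+ (m * suc n + t)) (sym (length-insertions b v p)))) ⟩
  nth (insertions b v p ++ expand v (not b) ps) (length (insertions b v p) + (m * suc n + t))
    ≡⟨ nth-++ʳ (insertions b v p) _ (m * suc n + t) ⟩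
  nth (expand v (not b) ps) (m * suc n + t)
    ≡⟨ nth-expand v (not b) ps lengths m< t≤ ⟩
  insertAt v (insertionPos (startParity (not b) ℙ.+ parity m) n t) (nth ps m)
    ≡⟨ cong (λ c → insertAt v (insertionPos c n t) (nth ps m)) (startParity-not b m) ⟩
  insertAt v (insertionPos (startParity b ℙ.+ parity (suc m)) n t) (nth ps m) ∎
  where open ≡-Reasoning

All-IsPerm-expand : ∀ {n} b L → All (IsPerm n) L → All (IsPerm (suc n)) (expand (suc n) b L)
All-IsPerm-expand b [] [] = []
All-IsPerm-expand {n} b (p ∷ ps) (p↭ ∷ ps↭) rewrite expand-∷ (suc n) b p ps =
  All.++⁺ (insertionsIsPerm b) (All-IsPerm-expand (not b) ps ps↭)
  where
  positionsIsPerm : ∀ js → All (IsPerm (suc n)) (map (λ j → insertAt (suc n) j p) js)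
  positionsIsPerm js = All.map⁺ (All.universal {P = λ j → IsPerm (suc n) (insertAt (suc n) j p)}
                                   (λ j → IsPerm-insertAt j p↭) js)
  insertionsIsPerm : ∀ b → All (IsPerm (suc n)) (insertions b (suc n) p)
  insertionsIsPerm true = positionsIsPerm (reverse (upTo (suc (length p))))
  insertionsIsPerm false = positionsIsPerm (upTo (suc (length p)))

insertionPos-≤ : ∀ c {n t} → t ≤ n → insertionPos c n t ≤ n
insertionPos-≤ 0ℙ {n} {t} _ = m∸n≤m n t
insertionPos-≤ 1ℙ t≤ = t≤

2+[u∸3]≤u : ∀ {u} → 3 ≤ u → 2 + (u ∸ 3) ≤ u
2+[u∸3]≤u {suc (suc (suc u))} (s≤s (s≤s (s≤s _))) = n≤1+n (2 + u)

insertionPos-+3 : ∀ c {n t} → t + 3 ≤ n →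
  2 + insertionPos c n t ≤ insertionPos c n (t + 3) ⊎ 2 + insertionPos c n (t + 3) ≤ insertionPos c n t
insertionPos-+3 0ℙ {n} {t} t+3≤ = inj₂ (subst (λ x → 2 + x ≤ n ∸ t) (∸-+-assoc n t 3)
  (2+[u∸3]≤u (m+n≤o⇒m≤o∸n 3 (subst (_≤ n) (+-comm t 3) t+3≤))))
insertionPos-+3 1ℙ {t = t} _ = inj₁ (≤-trans (n≤1+n (2 + t)) (≤-reflexive (+-comm 3 t)))

[4+k]∸[2+k+e]≡2∸e : ∀ k e → 4 + k ∸ (2 + k + e) ≡ 2 ∸ e
[4+k]∸[2+k+e]≡2∸e zero e = refl
[4+k]∸[2+k+e]≡2∸e (suc k) e = [4+k]∸[2+k+e]≡2∸e k e

insertionStep-crossing : ∀ c k e {π π′} → e ≤ 2 →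
  InsertionStep (insertionPos c (4 + k) (2 + k + e)) π (insertionPos (c ⁻¹) (4 + k) e) π′ → e ≡ 1
insertionStep-crossing 0ℙ k 0 _ step rewrite [4+k]∸[2+k+e]≡2∸e k 0 =
  ⊥-elim (insertionStep-far ≤-refl (insertionStep-sym step))
insertionStep-crossing 0ℙ k 2 _ step rewrite [4+k]∸[2+k+e]≡2∸e k 2 = ⊥-elim (insertionStep-far ≤-refl step)
insertionStep-crossing 1ℙ k 0 _ step =
  ⊥-elim (insertionStep-far (≤-reflexive (cong (4 +_) (+-identityʳ k))) step)
insertionStep-crossing 1ℙ k 2 _ step =
  ⊥-elim (insertionStep-far (≤-reflexive (+-comm 2 (2 + k))) (insertionStep-sym step))
insertionStep-crossing c k 1 _ _ = refl
insertionStep-crossing c k (suc (suc (suc e))) (s≤s (s≤s ())) _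

frontOffset : Parity → ℕ → ℕ
frontOffset 0ℙ n = n
frontOffset 1ℙ n = 0

frontOffset-≤ : ∀ c n → frontOffset c n ≤ n
frontOffset-≤ 0ℙ n = ≤-refl
frontOffset-≤ 1ℙ n = z≤n

insertionPos-frontOffset : ∀ c n → insertionPos c n (frontOffset c n) ≡ 0
insertionPos-frontOffset 0ℙ n = n∸n≡0 n
insertionPos-frontOffset 1ℙ n = refl

insertionPos-frontOffset-ends : ∀ c c′ n →
  insertionPos c′ n (frontOffset c n) ≡ 0 ⊎ insertionPos c′ n (frontOffset c n) ≡ n
insertionPos-frontOffset-ends 0ℙ 0ℙ n = inj₁ (n∸n≡0 n)
insertionPos-frontOffset-ends 0ℙ 1ℙ n = inj₂ refl
insertionPos-frontOffset-ends 1ℙ 0ℙ n = inj₂ refl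
insertionPos-frontOffset-ends 1ℙ 1ℙ n = inj₁ refl

sjt : ℕ → ℕ → List ℕ
sjt n i = nth (SJT n) i

sjtLength : ℕ → ℕ
sjtLength n = length (SJT n)

All-IsPerm-SJT : ∀ n → All (IsPerm (suc n)) (SJT (suc n))
All-IsPerm-SJT zero = ↭-refl ∷ []
All-IsPerm-SJT (suc n) = All-IsPerm-expand true (SJT (suc n)) (All-IsPerm-SJT n)

IsPerm-sjt : ∀ n {i} → i < sjtLength (suc n) → IsPerm (suc n) (sjt (suc n) i)
IsPerm-sjt n i< = nth-All _ (All-IsPerm-SJT n) i<

All-length-SJT : ∀ n → All (λ p → length p ≡ suc n) (SJT (suc n))
All-length-SJT n = All.map IsPerm-length (All-IsPerm-SJT n)

sjtLength-suc : ∀ n → sjtLength (2 + n) ≡ sjtLength (suc n) * (2 + n)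
sjtLength-suc n = length-expand (2 + n) true (SJT (suc n)) (All-length-SJT n)

sjt-block : ∀ n {m t} → m < sjtLength (suc n) → t ≤ suc n →
  sjt (2 + n) (m * (2 + n) + t) ≡ insertAt (2 + n) (insertionPos (parity m) (suc n) t) (sjt (suc n) m)
sjt-block n = nth-expand (2 + n) true (SJT (suc n)) (All-length-SJT n)

0<sjtLength : ∀ n → 0 < sjtLength (suc n)
0<sjtLength zero = s≤s z≤n
0<sjtLength (suc n) =
  subst (0 <_) (sym (sjtLength-suc n)) (<-≤-trans (0<sjtLength n) (m≤m*n (sjtLength (suc n)) (2 + n)))

24≤sjtLength : ∀ k → 24 ≤ sjtLength (4 + k)
24≤sjtLength zero = ≤-refl
24≤sjtLength (suc k) =
  subst (24 ≤_) (sym (sjtLength-suc (3 + k))) (≤-trans (24≤sjtLength k) (m≤m*n (sjtLength (4 + k)) (5 + k)))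

blockDecomposition : ∀ L d {i} → i < L * suc d → ∃ λ m → ∃ λ t → m < L × t ≤ d × i ≡ m * suc d + t
blockDecomposition L d {i} i< =
  i / suc d , i % suc d , m<n*o⇒m/o<n i< , ≤-pred (m%n<n i (suc d)) ,
  trans (m≡m%n+[m/n]*n i (suc d)) (+-comm (i % suc d) _)

block-< : ∀ {L k m t} → m < L → t < k → m * k + t < L * k
block-< {L} {k} {m} {t} m< t< = begin-strict
  m * k + t  <⟨ +-monoʳ-< (m * k) t< ⟩
  m * k + k  ≡⟨ +-comm (m * k) k ⟩
  suc m * k  ≤⟨ *-monoˡ-≤ k m< ⟩
  L * k      ∎
  where open ≤-Reasoning

shiftIdx-< : ∀ {N} s i → i + s < N → shiftIdx N s i ≡ i + s
shiftIdx-< {N} s i i+s< with (i + s) <ᵇ N | <⇒<ᵇ i+s<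
... | true | _ = refl

shiftIdx-≥ : ∀ {N} s i → N ≤ i + s → shiftIdx N s i ≡ i + s ∸ N
shiftIdx-≥ {N} s i N≤ with (i + s) <ᵇ N in eq
... | false = refl
... | true = ⊥-elim (<⇒≱ (<ᵇ⇒< (i + s) N (subst T (sym eq) tt)) N≤)

shiftIdx-bound : ∀ {N s i} → i < N → s ≤ N → shiftIdx N s i < N
shiftIdx-bound {N} {s} {i} i< s≤ with i + s <? N
... | yes i+s< = subst (_< N) (sym (shiftIdx-< s i i+s<)) i+s<
... | no i+s≮ = subst (_< N) (sym (shiftIdx-≥ s i (≮⇒≥ i+s≮))) (begin-strict
  i + s ∸ N  <⟨ ∸-monoˡ-< (+-mono-<-≤ i< s≤) (≮⇒≥ i+s≮) ⟩
  N + N ∸ N  ≡⟨ m+n∸n≡m N N ⟩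
  N          ∎)
  where open ≤-Reasoning

shiftIdx-block : ∀ {L k} s {m t} → m < L → t < k → shiftIdx (L * k) (s * k) (m * k + t) ≡ shiftIdx L s m * k + t
shiftIdx-block {L} {k} s {m} {t} m< t< = byWrap (m + s <? L)
  where
  open ≡-Reasoning
  regroup : m * k + t + s * k ≡ (m + s) * k + t
  regroup = rearrange m k t s
    where
    rearrange : ∀ m k t s → m * k + t + s * k ≡ (m + s) * k + t
    rearrange = solve-∀
  byWrap : Dec (m + s < L) → shiftIdx (L * k) (s * k) (m * k + t) ≡ shiftIdx L s m * k + t
  byWrap (yes m+s<) = begin
    shiftIdx (L * k) (s * k) (m * k + t) ≡⟨ shiftIdx-< (s * k) (m * k + t) (subst (_< L * k) (sym regroup) (block-< m+s< t<)) ⟩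
    m * k + t + s * k                    ≡⟨ regroup ⟩
    (m + s) * k + t                      ≡⟨ cong (λ j → j * k + t) (shiftIdx-< s m m+s<) ⟨
    shiftIdx L s m * k + t               ∎
  byWrap (no m+s≮) = begin
    shiftIdx (L * k) (s * k) (m * k + t) ≡⟨ shiftIdx-≥ (s * k) (m * k + t) (subst (L * k ≤_) (sym regroup) (≤-trans Lk≤ (m≤m+n _ t))) ⟩
    m * k + t + s * k ∸ L * k            ≡⟨ cong (_∸ L * k) regroup ⟩
    (m + s) * k + t ∸ L * k              ≡⟨ +-∸-comm t Lk≤ ⟩
    ((m + s) * k ∸ L * k) + t            ≡⟨ cong (_+ t) (*-distribʳ-∸ k (m + s) L) ⟨
    (m + s ∸ L) * k + t                  ≡⟨ cong (λ j → j * k + t) (shiftIdx-≥ s m (≮⇒≥ m+s≮)) ⟨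
    shiftIdx L s m * k + t               ∎
    where
    Lk≤ : L * k ≤ (m + s) * k
    Lk≤ = *-monoˡ-≤ k (≮⇒≥ m+s≮)

parity-shiftIdx : ∀ N s i → parity N ≡ 0ℙ → parity s ≡ 0ℙ → parity (shiftIdx N s i) ≡ parity i
parity-shiftIdx N s i N-even s-even with i + s <? N
... | yes i+s< = begin
  parity (shiftIdx N s i)     ≡⟨ cong parity (shiftIdx-< s i i+s<) ⟩
  parity (i + s)              ≡⟨ ℙ.+-homo-+ i s ⟩
  parity i ℙ.+ parity s       ≡⟨ cong (parity i ℙ.+_) s-even ⟩
  parity i ℙ.+ 0ℙ             ≡⟨ ℙ.+-identityʳ (parity i) ⟩
  parity i                    ∎
  where open ≡-Reasoning
... | no i+s≮ = begin
  parity (shiftIdx N s i)     ≡⟨ cong parity (shiftIdx-≥ s i (≮⇒≥ i+s≮)) ⟩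
  parity (i + s ∸ N)          ≡⟨ ℙ.+-identityʳ _ ⟨
  parity (i + s ∸ N) ℙ.+ 0ℙ   ≡⟨ cong (parity (i + s ∸ N) ℙ.+_) N-even ⟨
  parity (i + s ∸ N) ℙ.+ parity N ≡⟨ ℙ.+-homo-+ (i + s ∸ N) N ⟨
  parity (i + s ∸ N + N)      ≡⟨ cong parity (m∸n+n≡m (≮⇒≥ i+s≮)) ⟩
  parity (i + s)              ≡⟨ ℙ.+-homo-+ i s ⟩
  parity i ℙ.+ parity s       ≡⟨ cong (parity i ℙ.+_) s-even ⟩
  parity i ℙ.+ 0ℙ             ≡⟨ ℙ.+-identityʳ (parity i) ⟩
  parity i                    ∎
  where open ≡-Reasoning

ShiftedBy : (List ℕ → List ℕ) → List (List ℕ) → ℕ → Set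
ShiftedBy f C s = ∀ {i} → i < length C → f (nth C i) ≡ nth C (shiftIdx (length C) s i)

shiftedBy? : ∀ f C s → Dec (ShiftedBy f C s)
shiftedBy? f C s = allUpTo? (λ i → List.≡-dec _≟_ (f (nth C i)) (nth C (shiftIdx (length C) s i))) (length C)

τ : ℕ → ℕ
τ 1 = 3
τ 2 = 1
τ 3 = 2
τ x = x

τ⁻¹ : ℕ → ℕ
τ⁻¹ 1 = 2
τ⁻¹ 2 = 3
τ⁻¹ 3 = 1
τ⁻¹ x = x

τ⁻¹∘τ : ∀ x → τ⁻¹ (τ x) ≡ x
τ⁻¹∘τ 0 = refl
τ⁻¹∘τ 1 = refl
τ⁻¹∘τ 2 = refl
τ⁻¹∘τ 3 = refl
τ⁻¹∘τ (suc (suc (suc (suc x)))) = refl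

τ∘τ⁻¹ : ∀ x → τ (τ⁻¹ x) ≡ x
τ∘τ⁻¹ 0 = refl
τ∘τ⁻¹ 1 = refl
τ∘τ⁻¹ 2 = refl
τ∘τ⁻¹ 3 = refl
τ∘τ⁻¹ (suc (suc (suc (suc x)))) = refl

IsAutΠ-τ : ∀ k → IsAutΠ (3 + k) (map τ)
IsAutΠ-τ = IsAutΠ-relabel _ τ τ⁻¹ τ⁻¹∘τ τ∘τ⁻¹
  ∘ map-oneTo-↭ 3 τ (λ _ → refl) (↭-trans (swap 3 1 ↭-refl) (prep 1 (swap 3 2 ↭-refl)))

IsAutΠ-τ⁻¹ : ∀ k → IsAutΠ (3 + k) (map τ⁻¹)
IsAutΠ-τ⁻¹ = IsAutΠ-relabel _ τ⁻¹ τ τ∘τ⁻¹ τ⁻¹∘τ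
  ∘ map-oneTo-↭ 3 τ⁻¹ (λ _ → refl) (↭-trans (prep 2 (swap 3 1 ↭-refl)) (swap 2 1 ↭-refl))

-- third k = (3 + k)! / 3
third : ℕ → ℕ
third zero = 2
third (suc k) = third k * (4 + k)

sjtLength-third : ∀ k → sjtLength (3 + k) ≡ third k * 3
sjtLength-third zero = refl
sjtLength-third (suc k) = begin
  sjtLength (4 + k)           ≡⟨ sjtLength-suc (2 + k) ⟩
  sjtLength (3 + k) * (4 + k) ≡⟨ cong (_* (4 + k)) (sjtLength-third k) ⟩
  third k * 3 * (4 + k)       ≡⟨ *-assoc (third k) 3 (4 + k) ⟩
  third k * (3 * (4 + k))     ≡⟨ cong (third k *_) (*-comm 3 (4 + k)) ⟩
  third k * ((4 + k) * 3)     ≡⟨ *-assoc (third k) (4 + k) 3 ⟨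
  third (suc k) * 3           ∎
  where open ≡-Reasoning

parity-third : ∀ k → parity (third k) ≡ 0ℙ
parity-third zero = refl
parity-third (suc k) = trans (ℙ.*-homo-* (third k) (4 + k)) (cong (ℙ._* parity (4 + k)) (parity-third k))

parity-sjtLength : ∀ k → parity (sjtLength (3 + k)) ≡ 0ℙ
parity-sjtLength k = trans (cong parity (sjtLength-third k))
  (trans (ℙ.*-homo-* (third k) 3) (cong (ℙ._* 1ℙ) (parity-third k)))

third≤sjtLength : ∀ k → third k ≤ sjtLength (3 + k)
third≤sjtLength k = subst (third k ≤_) (sym (sjtLength-third k)) (m≤m*n (third k) 3)

sjt-τ : ∀ k → ShiftedBy (map τ) (SJT (3 + k)) (third k)
sjt-τ zero = from-yes (shiftedBy? (map τ) (SJT 3) 2)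
sjt-τ (suc k) {i} i<
  with m , t , m< , t≤ , refl ← blockDecomposition (sjtLength (3 + k)) (3 + k) (subst (i <_) (sjtLength-suc (2 + k)) i<) =
  begin
  map τ (sjt D (m * D + t))
    ≡⟨ cong (map τ) (sjt-block (2 + k) m< t≤) ⟩
  map τ (insertAt D (insertionPos (parity m) (3 + k) t) (sjt (3 + k) m))
    ≡⟨ map-insertAt τ D _ _ ⟩
  insertAt D (insertionPos (parity m) (3 + k) t) (map τ (sjt (3 + k) m))
    ≡⟨ cong (insertAt D _) (sjt-τ k m<) ⟩
  insertAt D (insertionPos (parity m) (3 + k) t) (sjt (3 + k) m′)
    ≡⟨ cong (λ c → insertAt D (insertionPos c (3 + k) t) (sjt (3 + k) m′))
         (parity-shiftIdx L (third k) m (parity-sjtLength k) (parity-third k)) ⟨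
  insertAt D (insertionPos (parity m′) (3 + k) t) (sjt (3 + k) m′)
    ≡⟨ sjt-block (2 + k) (shiftIdx-bound m< (third≤sjtLength k)) t≤ ⟨
  sjt D (m′ * D + t)
    ≡⟨ cong (sjt D) (shiftIdx-block (third k) m< (s≤s t≤)) ⟨
  sjt D (shiftIdx (L * D) (third k * D) (m * D + t))
    ≡⟨ cong (λ N → sjt D (shiftIdx N (third (suc k)) (m * D + t))) (sjtLength-suc (2 + k)) ⟨
  sjt D (shiftIdx (sjtLength D) (third (suc k)) (m * D + t)) ∎
  where
  open ≡-Reasoning
  D L m′ : ℕ
  D = 4 + k
  L = sjtLength (3 + k)
  m′ = shiftIdx L (third k) m

KSymmetric-3 : ∀ k → KSymmetric (3 + k) (SJT (3 + k)) 3
KSymmetric-3 k = s≤s z≤n , third k , sym (sjtLength-third k) , map τ , IsAutΠ-τ k , λ _ → sjt-τ k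

KSymmetric-6 : ∀ k s → ShiftedBy (map τ⁻¹ ∘ reverse) (SJT (3 + k)) s → s * 6 ≡ sjtLength (3 + k) →
  KSymmetric (3 + k) (SJT (3 + k)) 6
KSymmetric-6 k s shifted s*6≡ =
  s≤s z≤n , s , s*6≡ , map τ⁻¹ ∘ reverse , IsAutΠ-∘ (IsAutΠ-τ⁻¹ k) (IsAutΠ-reverse (3 + k)) , λ _ → shifted

Adj-sjt-block⁻ : ∀ n {m t m′ t′} → m < sjtLength (suc n) → t ≤ suc n → m′ < sjtLength (suc n) → t′ ≤ suc n →
  Adj (sjt (2 + n) (m * (2 + n) + t)) (sjt (2 + n) (m′ * (2 + n) + t′)) →
  InsertionStep (insertionPos (parity m) (suc n) t) (sjt (suc n) m) (insertionPos (parity m′) (suc n) t′) (sjt (suc n) m′)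
Adj-sjt-block⁻ n {m} {t} {m′} {t′} m< t≤ m′< t′≤ adj =
  Adj-insertAt⁻ (IsPerm-∉ (IsPerm-sjt n m<)) (IsPerm-∉ (IsPerm-sjt n m′<))
    (position≤ (parity m) m< t≤) (position≤ (parity m′) m′< t′≤)
    (subst₂ Adj (sjt-block n m< t≤) (sjt-block n m′< t′≤) adj)
  where
  position≤ : ∀ c {x u} → x < sjtLength (suc n) → u ≤ suc n → insertionPos c (suc n) u ≤ length (sjt (suc n) x)
  position≤ c x< u≤ = subst (insertionPos c (suc n) _ ≤_) (sym (IsPerm-length (IsPerm-sjt n x<))) (insertionPos-≤ c u≤)

sjt-chord : ∀ k → Adj (sjt (5 + k) (3 + k)) (sjt (5 + k) (6 + k))
sjt-chord k = subst₂ Adj (sym x₃₊ₖ) (sym x₆₊ₖ) (Adj-sym (subst (Adj (insertAt D 1 x₁) ∘ insertAt D 1) (sym x₀≡) x₁x₀))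
  where
  D : ℕ
  D = 5 + k
  ρ x₀ x₁ : List ℕ
  ρ = sjt (3 + k) 0
  x₀ = sjt (4 + k) 0
  x₁ = sjt (4 + k) 1
  0<L : 0 < sjtLength (3 + k)
  0<L = 0<sjtLength (2 + k)
  1<L : 1 < sjtLength (4 + k)
  1<L = <-≤-trans (s≤s (s≤s z≤n)) (24≤sjtLength k)
  length-ρ : length ρ ≡ 3 + k
  length-ρ = IsPerm-length (IsPerm-sjt (2 + k) 0<L)
  x₀≡ : x₀ ≡ swapAt (2 + k) x₁
  x₀≡ = trans (sjt-block (2 + k) 0<L z≤n)
          (trans (insertAt-suc (4 + k) (2 + k) ρ (≤-reflexive (sym length-ρ)))
                 (cong (swapAt (2 + k)) (sym (sjt-block (2 + k) 0<L (s≤s z≤n)))))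
  x₁x₀ : Adj (insertAt D 1 x₁) (insertAt D 1 (swapAt (2 + k) x₁))
  x₁x₀ = Adj-insertAt-left D (s≤s z≤n) (subst (3 + k <_) (sym (IsPerm-length (IsPerm-sjt (3 + k) 1<L))) ≤-refl)
  x₃₊ₖ : sjt D (3 + k) ≡ insertAt D 1 x₀
  x₃₊ₖ = trans (sjt-block (3 + k) (0<sjtLength (3 + k)) (n≤1+n (3 + k)))
           (cong (λ j → insertAt D j x₀) (m+n∸n≡m 1 (3 + k)))
  x₆₊ₖ : sjt D (6 + k) ≡ insertAt D 1 x₁
  x₆₊ₖ = trans (cong (sjt D) (sym (trans (cong (_+ 1) (*-identityˡ D)) (+-comm D 1))))
           (sjt-block (3 + k) 1<L (s≤s z≤n))

¬Adj-sjt-block-+3 : ∀ n {m t} → m < sjtLength (suc n) → t + 3 ≤ suc n →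
  ¬ Adj (sjt (2 + n) (m * (2 + n) + t)) (sjt (2 + n) (m * (2 + n) + (t + 3)))
¬Adj-sjt-block-+3 n {m} {t} m< t+3≤ adj =
  Sum.[ (λ apart → insertionStep-far apart step) , (λ apart → insertionStep-far apart (insertionStep-sym step)) ]′
    (insertionPos-+3 (parity m) t+3≤)
  where
  step : InsertionStep (insertionPos (parity m) (suc n) t) (sjt (suc n) m)
                       (insertionPos (parity m) (suc n) (t + 3)) (sjt (suc n) m)
  step = Adj-sjt-block⁻ n m< (m+n≤o⇒m≤o t t+3≤) m< t+3≤ adj

Adj-sjt-crossing : ∀ k {m e} → suc m < sjtLength (4 + k) → e ≤ 2 →
  Adj (sjt (5 + k) (m * (5 + k) + (2 + k + e))) (sjt (5 + k) (suc m * (5 + k) + e)) → e ≡ 1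
Adj-sjt-crossing k {m} {e} m+1< e≤2 adj = insertionStep-crossing (parity m) k e e≤2
  (subst (λ c → InsertionStep (insertionPos (parity m) (4 + k) (2 + k + e)) (sjt (4 + k) m)
                             (insertionPos c (4 + k) e) (sjt (4 + k) (suc m)))
         (parity-suc m)
    (Adj-sjt-block⁻ (3 + k) (<-trans (n<1+n m) m+1<) (≤-trans (+-monoʳ-≤ (2 + k) e≤2) (≤-reflexive (+-comm (2 + k) 2)))
      m+1< (≤-trans e≤2 (s≤s (s≤s z≤n))) adj))

Adj-sjt-+3 : ∀ k {j} → 3 + j < sjtLength (5 + k) → Adj (sjt (5 + k) j) (sjt (5 + k) (3 + j)) →
  ∃ λ m → j ≡ m * (5 + k) + (3 + k)
Adj-sjt-+3 k {j} 3+j< adj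
  with m , t , m< , t≤ , refl ← blockDecomposition (sjtLength (4 + k)) (4 + k)
                                   (subst (j <_) (sjtLength-suc (3 + k)) (m+n≤o⇒n≤o 3 3+j<))
  with t + 3 ≤? 4 + k
... | yes t+3≤ = ⊥-elim (¬Adj-sjt-block-+3 (3 + k) m< t+3≤
                   (subst (Adj (sjt (5 + k) (m * (5 + k) + t)) ∘ sjt (5 + k)) (trans (+-comm 3 _) (+-assoc (m * (5 + k)) t 3)) adj))
... | no t+3≰ = m , cong (m * D +_) (trans (sym t≡) (trans (cong (2 + k +_) e≡1) (+-comm (2 + k) 1)))
  where
  D : ℕ
  D = 5 + k
  2+k≤t : 2 + k ≤ t
  2+k≤t = ≤-pred (≤-pred (≤-pred (subst (5 + k ≤_) (+-comm t 3) (≰⇒> t+3≰))))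
  e : ℕ
  e = t ∸ (2 + k)
  t≡ : 2 + k + e ≡ t
  t≡ = m+[n∸m]≡n 2+k≤t
  e≤2 : e ≤ 2
  e≤2 = subst (e ≤_) (m+n∸n≡m 2 (2 + k)) (∸-monoˡ-≤ (2 + k) t≤)
  index≡ : 3 + (m * D + t) ≡ suc m * D + e
  index≡ = trans (cong (λ x → 3 + (m * D + x)) (sym t≡)) (rearrange m k e)
    where
    rearrange : ∀ m k e → 3 + (m * (5 + k) + (2 + k + e)) ≡ suc m * (5 + k) + e
    rearrange = solve-∀
  m+1< : suc m < sjtLength (4 + k)
  m+1< = *-cancelʳ-< D (suc m) _ (≤-<-trans (m≤m+n (suc m * D) e)
           (subst₂ _<_ index≡ (sjtLength-suc (3 + k)) 3+j<))
  e≡1 : e ≡ 1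
  e≡1 = Adj-sjt-crossing k m+1< e≤2 (subst₂ Adj (cong (sjt D ∘ (m * D +_)) (sym t≡)) (cong (sjt D) index≡) adj)

PreservesAdj : ℕ → ℕ → Set
PreservesAdj n s = ∀ {i j} → i < sjtLength n → j < sjtLength n → Adj (sjt n i) (sjt n j) →
  Adj (sjt n (shiftIdx (sjtLength n) s i)) (sjt n (shiftIdx (sjtLength n) s j))

KSymmetric⇒PreservesAdj : ∀ n {k} → KSymmetric (suc n) (SJT (suc n)) k →
  ∃ λ s → s * k ≡ sjtLength (suc n) × PreservesAdj (suc n) s
KSymmetric⇒PreservesAdj n (_ , s , s*k≡ , f , (_ , _ , _ , f-adj) , f-shift) =
  s , s*k≡ , λ i< j< adj → subst₂ Adj (f-shift _ i<) (f-shift _ j<)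
    (Equivalence.to (f-adj _ _ (IsPerm-sjt n i<) (IsPerm-sjt n j<)) adj)

¬PreservesAdj-witness : ∀ n s i j {i< : True (i <? sjtLength n)} {j< : True (j <? sjtLength n)}
  {adj : True (Adj? (sjt n i) (sjt n j))}
  {¬adj : False (Adj? (sjt n (shiftIdx (sjtLength n) s i)) (sjt n (shiftIdx (sjtLength n) s j)))} →
  ¬ PreservesAdj n s
¬PreservesAdj-witness n s i j {i<} {j<} {adj} {¬adj} preserves =
  toWitnessFalse ¬adj (preserves (toWitness i<) (toWitness j<) (toWitness adj))

-- An edge x_a x_b of Λ_{n+2} yields an edge between the entries of Λ_{n+3} carrying n + 3 in
-- front; their rotated images carry n + 3 at an end, where it cannot take part in a swap.
PreservesAdj-unblock : ∀ n {m} → m ≤ sjtLength (2 + n) → PreservesAdj (3 + n) (m * (3 + n)) →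
  PreservesAdj (2 + n) m
PreservesAdj-unblock n {m} m≤ preserves {a} {b} a< b< adj =
  insertionStep-ends (s≤s (s≤s z≤n))
    (insertionPos-frontOffset-ends (parity a) (parity (rotate a)) (2 + n))
    (insertionPos-frontOffset-ends (parity b) (parity (rotate b)) (2 + n))
    (Adj-sjt-block⁻ (suc n) (shiftIdx-bound a< m≤) (frontOffset-≤ _ _) (shiftIdx-bound b< m≤) (frontOffset-≤ _ _)
      (subst₂ Adj (shifted a<) (shifted b<)
        (preserves (front< a<) (front< b<) (subst₂ Adj (sym (front a<)) (sym (front b<)) (Adj-∷ D adj)))))
  where
  D L : ℕ
  D = 3 + n
  L = sjtLength (2 + n)
  rotate : ℕ → ℕ
  rotate = shiftIdx L m
  frontIdx : ℕ → ℕ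
  frontIdx x = x * D + frontOffset (parity x) (2 + n)
  front : ∀ {x} → x < L → sjt D (frontIdx x) ≡ D ∷ sjt (2 + n) x
  front {x} x< = trans (sjt-block (suc n) x< (frontOffset-≤ _ _))
    (cong (λ j → insertAt D j (sjt (2 + n) x)) (insertionPos-frontOffset (parity x) (2 + n)))
  front< : ∀ {x} → x < L → frontIdx x < sjtLength D
  front< {x} x< = subst (frontIdx x <_) (sym (sjtLength-suc (suc n))) (block-< x< (s≤s (frontOffset-≤ (parity x) _)))
  shifted : ∀ {x} → x < L →
    sjt D (shiftIdx (sjtLength D) (m * D) (frontIdx x)) ≡ sjt D (rotate x * D + frontOffset (parity x) (2 + n))
  shifted {x} x< = cong (sjt D) (trans (cong (λ N → shiftIdx N (m * D) (frontIdx x)) (sjtLength-suc (suc n)))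
                                       (shiftIdx-block m x< (s≤s (frontOffset-≤ (parity x) _))))

a+s<M : ∀ a s {M} → 2 * a < M → 2 * s ≤ M → a + s < M
a+s<M a s {M} 2a< 2s≤ = *-cancelˡ-< 2 (a + s) M (begin-strict
  2 * (a + s)    ≡⟨ *-distribˡ-+ 2 a s ⟩
  2 * a + 2 * s  <⟨ +-mono-<-≤ 2a< 2s≤ ⟩
  M + M          ≡⟨ cong (M +_) (+-identityʳ M) ⟨
  2 * M          ∎)
  where open ≤-Reasoning

2*[6+k]<sjtLength : ∀ k → 2 * (6 + k) < sjtLength (5 + k)
2*[6+k]<sjtLength k = begin-strict
  2 * (6 + k)                     <⟨ m<m+n (2 * (6 + k)) (s≤s z≤n) ⟩
  2 * (6 + k) + (108 + 22 * k)    ≡⟨ expand24 k ⟨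
  24 * (5 + k)                    ≤⟨ *-monoˡ-≤ (5 + k) (24≤sjtLength k) ⟩
  sjtLength (4 + k) * (5 + k)     ≡⟨ sjtLength-suc (3 + k) ⟨
  sjtLength (5 + k)               ∎
  where
  open ≤-Reasoning
  expand24 : ∀ k → 24 * (5 + k) ≡ 2 * (6 + k) + (108 + 22 * k)
  expand24 = solve-∀

-- The rotation moves the edge sjt-chord to a pair of entries three apart, which Adj-sjt-+3
-- places at offset n - 2 of a block of Λ_n.
PreservesAdj-divisible : ∀ k {s} → 4 * s ≤ sjtLength (5 + k) → PreservesAdj (5 + k) s → ∃ λ m → s ≡ m * (5 + k)
PreservesAdj-divisible k {s} 4s≤ preserves =
  m , +-cancelˡ-≡ (3 + k) s (m * (5 + k)) (trans j≡ (+-comm (m * (5 + k)) (3 + k)))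
  where
  6+k+s< : 6 + k + s < sjtLength (5 + k)
  6+k+s< = a+s<M (6 + k) s (2*[6+k]<sjtLength k) (≤-trans (*-monoˡ-≤ s {2} {4} (s≤s (s≤s z≤n))) 4s≤)
  3+k+s< : 3 + k + s < sjtLength (5 + k)
  3+k+s< = ≤-<-trans (+-monoˡ-≤ s (m≤n+m (3 + k) 3)) 6+k+s<
  6+k< : 6 + k < sjtLength (5 + k)
  6+k< = ≤-<-trans (m≤m+n (6 + k) s) 6+k+s<
  3+k< : 3 + k < sjtLength (5 + k)
  3+k< = ≤-<-trans (m≤n+m (3 + k) 3) 6+k<
  shiftedChord : Adj (sjt (5 + k) (3 + k + s)) (sjt (5 + k) (6 + k + s))
  shiftedChord = subst₂ Adj (cong (sjt (5 + k)) (shiftIdx-< s (3 + k) 3+k+s<))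
                            (cong (sjt (5 + k)) (shiftIdx-< s (6 + k) 6+k+s<))
                            (preserves 3+k< 6+k< (sjt-chord k))
  m : ℕ
  m = proj₁ (Adj-sjt-+3 k 6+k+s< shiftedChord)
  j≡ : 3 + k + s ≡ m * (5 + k) + (3 + k)
  j≡ = proj₂ (Adj-sjt-+3 k 6+k+s< shiftedChord)

¬PreservesAdj₄ : ∀ {s} → 0 < s → 7 * s ≤ sjtLength 4 → ¬ PreservesAdj 4 s
¬PreservesAdj₄ {1} _ _ = ¬PreservesAdj-witness 4 1 0 7
¬PreservesAdj₄ {2} _ _ = ¬PreservesAdj-witness 4 2 0 7
¬PreservesAdj₄ {3} _ _ = ¬PreservesAdj-witness 4 3 0 7
¬PreservesAdj₄ {suc (suc (suc (suc s)))} _ 7s≤ =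
  ⊥-elim (from-no (28 ≤? 24) (≤-trans (*-monoʳ-≤ 7 (s≤s (s≤s (s≤s (s≤s (z≤n {s})))))) 7s≤))

-- Rotating Λ₄ by 4 is its six-fold symmetry, so m = 4 is refuted in Λ₅ instead.
¬PreservesAdj₅ : ∀ {m} → 0 < m → m ≤ 6 → PreservesAdj 4 m → ¬ PreservesAdj 5 (m * 5)
¬PreservesAdj₅ {1} _ _ preserves₄ _ = ¬PreservesAdj-witness 4 1 0 7 preserves₄
¬PreservesAdj₅ {2} _ _ preserves₄ _ = ¬PreservesAdj-witness 4 2 0 7 preserves₄
¬PreservesAdj₅ {3} _ _ preserves₄ _ = ¬PreservesAdj-witness 4 3 0 7 preserves₄
¬PreservesAdj₅ {4} _ _ _ = ¬PreservesAdj-witness 5 20 1 118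
¬PreservesAdj₅ {5} _ _ preserves₄ _ = ¬PreservesAdj-witness 4 5 0 7 preserves₄
¬PreservesAdj₅ {6} _ _ preserves₄ _ = ¬PreservesAdj-witness 4 6 0 7 preserves₄
¬PreservesAdj₅ {suc (suc (suc (suc (suc (suc (suc _))))))} _ (s≤s (s≤s (s≤s (s≤s (s≤s (s≤s ()))))))

PreservesAdj-descend : ∀ k {s} → 0 < s → 4 * s ≤ sjtLength (5 + k) → PreservesAdj (5 + k) s →
  ∃ λ m → s ≡ m * (5 + k) × 0 < m × 4 * m ≤ sjtLength (4 + k) × PreservesAdj (4 + k) m
PreservesAdj-descend k {s} 0<s 4s≤ preserves =
  m , s≡ , 0<m , 4m≤ , PreservesAdj-unblock (2 + k) (≤-trans (m≤n*m m 4) 4m≤) (subst (PreservesAdj (5 + k)) s≡ preserves)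
  where
  D : ℕ
  D = 5 + k
  m : ℕ
  m = proj₁ (PreservesAdj-divisible k 4s≤ preserves)
  s≡ : s ≡ m * D
  s≡ = proj₂ (PreservesAdj-divisible k 4s≤ preserves)
  0<m : 0 < m
  0<m = n≢0⇒n>0 (λ m≡0 → n>0⇒n≢0 0<s (trans s≡ (cong (_* D) m≡0)))
  4m≤ : 4 * m ≤ sjtLength (4 + k)
  4m≤ = *-cancelʳ-≤ (4 * m) (sjtLength (4 + k)) D
          (subst₂ _≤_ (trans (cong (4 *_) s≡) (sym (*-assoc 4 m D))) (sjtLength-suc (3 + k)) 4s≤)

¬PreservesAdj-≥5 : ∀ k {s} → 0 < s → 4 * s ≤ sjtLength (5 + k) → ¬ PreservesAdj (5 + k) s
¬PreservesAdj-≥5 zero 0<s 4s≤ preserves =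
  let m , s≡ , 0<m , 4m≤ , preserves₄ = PreservesAdj-descend zero 0<s 4s≤ preserves
  in ¬PreservesAdj₅ 0<m (*-cancelˡ-≤ 4 4m≤) preserves₄ (subst (PreservesAdj 5) s≡ preserves)
¬PreservesAdj-≥5 (suc k) 0<s 4s≤ preserves =
  let _ , _ , 0<m , 4m≤ , preserves′ = PreservesAdj-descend (suc k) 0<s 4s≤ preserves
  in ¬PreservesAdj-≥5 k 0<m 4m≤ preserves′

KSymmetric-≤length : ∀ {n C k} → 0 < length C → KSymmetric n C k → k ≤ length C
KSymmetric-≤length 0<N (_ , zero , 0≡N , _) = ⊥-elim (<-irrefl 0≡N 0<N)
KSymmetric-≤length {k = k} _ (_ , suc s , s*k≡ , _) = subst (k ≤_) s*k≡ (m≤m+n k (s * k))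

KSymmetric-≤ : ∀ n c → (∀ {s} → 0 < s → suc c * s ≤ sjtLength (suc n) → ¬ PreservesAdj (suc n) s) →
  ∀ k → KSymmetric (suc n) (SJT (suc n)) k → k ≤ c
KSymmetric-≤ n c noShift k ksym with k ≤? c
... | yes k≤c = k≤c
... | no k≰c with KSymmetric⇒PreservesAdj n ksym
...   | zero , s*k≡ , _ = ⊥-elim (<-irrefl s*k≡ (0<sjtLength n))
...   | suc s , s*k≡ , preserves = ⊥-elim (noShift (s≤s z≤n) (begin
  suc c * suc s  ≤⟨ *-monoˡ-≤ (suc s) (≰⇒> k≰c) ⟩
  k * suc s      ≡⟨ *-comm k (suc s) ⟩
  suc s * k      ≡⟨ s*k≡ ⟩
  sjtLength (suc n) ∎) preserves)
  where open ≤-Reasoning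

proposition5p1 : CompressionFactor 3 (SJT 3) 6 × CompressionFactor 4 (SJT 4) 6 × (∀ n → 5 ≤ n → CompressionFactor n (SJT n) 3)
proposition5p1 =
  (KSymmetric-6 0 1 (from-yes (shiftedBy? (map τ⁻¹ ∘ reverse) (SJT 3) 1)) refl ,
   λ k → KSymmetric-≤length (s≤s z≤n)) ,
  (KSymmetric-6 1 4 (from-yes (shiftedBy? (map τ⁻¹ ∘ reverse) (SJT 4) 4)) refl ,
   KSymmetric-≤ 3 6 ¬PreservesAdj₄) ,
  λ { _ (s≤s (s≤s (s≤s (s≤s (s≤s {n = k} z≤n))))) → KSymmetric-3 (2 + k) , KSymmetric-≤ (4 + k) 3 (¬PreservesAdj-≥5 k) }
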